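{- There are infinitely many pairs $(b,y)$ of integers with $b\ge 2$, $y\ge 1$, for which there exists a word $w$ over $\{0,1,\dots,b-1\}$ with $|w|=1$ such that $(y^2)_b = w\uparrow 4$; equivalently, infinitely many positive integer solutions $(b,y,c)$ of $y^2=c(b^3+b^2+b+1)$ with $1\le c<b$.
   Context: $(m)_b$ denotes the canonical base-$b$ representation of the integer $m$ (no leading zeros); $|w|$ is the length of the word $w$ and $w\uparrow n$ is the concatenation of $n$ copies of $w$. -}

module Defs where

open import Data.Nat using (ℕ; zero; suc; _≤_; s≤s; _/_; _%_; NonZero)
open import Data.List using (List; []; _∷_; reverse; concat; replicate)

-- Little-endian base-b digits of n, computed with fuel (fuel ≥ n suffices when b ≥ 2).
-- Stops as soon as the number becomes 0, so there are no leading zeros.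
digitsLE : (fuel b n : ℕ) → .{{NonZero b}} → List ℕ
digitsLE zero b n = []
digitsLE (suc f) b zero = []
digitsLE (suc f) b (suc n) = (suc n % b) ∷ digitsLE f b (suc n / b)

-- (m)_b : canonical base-b representation of m, most significant digit first,
-- no leading zeros (so (0)_b is the empty word).
repr : (b m : ℕ) → .{{NonZero b}} → List ℕ
repr b m = reverse (digitsLE m b m)

_↑_ : {A : Set} → List A → ℕ → List A
w ↑ n = concat (replicate n w)

base≥2⇒NonZero : {b : ℕ} → 2 ≤ b → NonZero b
base≥2⇒NonZero {suc b} _ = _

{-# OPTIONS --safe #-}
-- Taking b = 2a + 1 and c = a + 1 gives c (b³ + b² + b + 1) = (2(a + 1))² (a² + (a + 1)²),
-- so the repdigit cccc in base b is a square exactly when a² + (a + 1)² is a square.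
-- Pythagorean triples with consecutive legs are produced without bound by the
-- map (a , s) ↦ (3a + 2s + 1 , 4a + 3s + 2), starting from (0 , 1).
module Submission where

open import Defs
open import Data.Nat using (ℕ; _≤_; _^_; suc)
open import Data.Fin using (Fin; toℕ)
open import Data.List using (List; length; map)
open import Data.Product using (Σ; _×_; _,_)
open import Relation.Nullary using (¬_)
open import Relation.Binary.PropositionalEquality using (_≡_)
open import Data.List.Membership.Propositional using (_∈_)

open import Data.Nat using (zero; _+_; _*_; _<_; z≤n; s≤s; z<s; NonZero; _/_; _%_)
open import Data.Nat.Properties
open import Data.Nat.DivMod using ([m+kn]%n≡m%n; m<n⇒m%n≡m; +-distrib-/-∣ʳ; m<n⇒m/n≡0; m*n/n≡m)
open import Data.Nat.Divisibility using (divides)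
open import Data.Nat.Solver using (module +-*-Solver)
open import Data.Digit using (Expansion; fromDigits)
open import Data.Fin using (fromℕ<)
open import Data.Fin.Properties using (toℕ<n; toℕ-fromℕ<)
open import Data.List using ([]; _∷_; reverse)
open import Data.List.Extrema.Nat using (max; xs≤max)
open import Data.List.Relation.Unary.All using (All; []; _∷_; lookup)
open import Data.List.Membership.Propositional.Properties using (∈-map⁺)
open import Data.Product using (proj₁)
open import Relation.Binary.PropositionalEquality using (refl; sym; cong; cong₂; module ≡-Reasoning)

open +-*-Solver

digitsLE-cons : ∀ f b .{{_ : NonZero b}} c q → 0 < c → c < b →
                digitsLE (suc f) b (c + q * b) ≡ c ∷ digitsLE f b q
digitsLE-cons f b (suc c) q _ c<b = cong₂ _∷_ remainder (cong (λ m → digitsLE f b m) quotient)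
  where
  open ≡-Reasoning
  remainder : (suc c + q * b) % b ≡ suc c
  remainder = begin
    (suc c + q * b) % b  ≡⟨ [m+kn]%n≡m%n (suc c) q b ⟩
    suc c % b            ≡⟨ m<n⇒m%n≡m c<b ⟩
    suc c                ∎
  quotient : (suc c + q * b) / b ≡ q
  quotient = begin
    (suc c + q * b) / b      ≡⟨ +-distrib-/-∣ʳ (suc c) (divides q refl) ⟩
    suc c / b + q * b / b    ≡⟨ cong₂ _+_ (m<n⇒m/n≡0 c<b) (m*n/n≡m q b) ⟩
    q                        ∎

NonZeroDigits : ∀ {b} → Expansion b → Set
NonZeroDigits = All (λ d → 0 < toℕ d)

length≤fromDigits : ∀ {b} .{{_ : NonZero b}} (ds : Expansion b) →
                    NonZeroDigits ds → length ds ≤ fromDigits ds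
length≤fromDigits         []       []         = z≤n
length≤fromDigits {b} (d ∷ ds) (d>0 ∷ ds>0) =
  +-mono-≤ d>0 (≤-trans (length≤fromDigits ds ds>0) (m≤m*n (fromDigits ds) b))

digitsLE-fromDigits : ∀ f {b} .{{_ : NonZero b}} (ds : Expansion b) →
                      NonZeroDigits ds → length ds ≤ f →
                      digitsLE f b (fromDigits ds) ≡ map toℕ ds
digitsLE-fromDigits zero    []       _            _  = refl
digitsLE-fromDigits (suc f) []       _            _  = refl
digitsLE-fromDigits (suc f) {b} (d ∷ ds) (d>0 ∷ ds>0) (s≤s len≤f) = begin
  digitsLE (suc f) b (toℕ d + fromDigits ds * b)  ≡⟨ digitsLE-cons f b (toℕ d) (fromDigits ds) d>0 (toℕ<n d) ⟩
  toℕ d ∷ digitsLE f b (fromDigits ds)            ≡⟨ cong (toℕ d ∷_) (digitsLE-fromDigits f ds ds>0 len≤f) ⟩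
  toℕ d ∷ map toℕ ds                              ∎
  where open ≡-Reasoning

repr-fromDigits : ∀ {b} .{{_ : NonZero b}} (ds : Expansion b) → NonZeroDigits ds →
                  repr b (fromDigits ds) ≡ reverse (map toℕ ds)
repr-fromDigits ds ds>0 =
  cong reverse (digitsLE-fromDigits (fromDigits ds) ds ds>0 (length≤fromDigits ds ds>0))

fromDigits-↑4 : ∀ {b} (d : Fin b) → fromDigits ((d ∷ []) ↑ 4) ≡ toℕ d * (1 + b + b ^ 2 + b ^ 3)
fromDigits-↑4 {b} d = solve 2 (λ x b → x :+ (x :+ (x :+ (x :+ con 0 :* b) :* b) :* b) :* b
                                      := x :* (con 1 :+ b :+ b :^ 2 :+ b :^ 3)) refl (toℕ d) b

ConsecutiveLegs : ℕ → ℕ → Set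
ConsecutiveLegs a s = a * a + suc a * suc a ≡ s * s

consecutiveLegs-next : ∀ {a s} → ConsecutiveLegs a s →
                       ConsecutiveLegs (3 * a + 2 * s + 1) (4 * a + 3 * s + 2)
consecutiveLegs-next {a} {s} legs = +-cancelʳ-≡ (s * s) _ _ (begin
  a′ * a′ + suc a′ * suc a′ + s * s      ≡⟨ identity a s ⟩
  s′ * s′ + (a * a + suc a * suc a)      ≡⟨ cong (s′ * s′ +_) legs ⟩
  s′ * s′ + s * s                        ∎)
  where
  open ≡-Reasoning
  a′ = 3 * a + 2 * s + 1
  s′ = 4 * a + 3 * s + 2
  identity : ∀ a s → let a′ = 3 * a + 2 * s + 1 ; s′ = 4 * a + 3 * s + 2 in
             a′ * a′ + suc a′ * suc a′ + s * s ≡ s′ * s′ + (a * a + suc a * suc a)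
  identity = solve 2 (λ a s →
    let a′ = con 3 :* a :+ con 2 :* s :+ con 1 ; s′ = con 4 :* a :+ con 3 :* s :+ con 2 in
    a′ :* a′ :+ (con 1 :+ a′) :* (con 1 :+ a′) :+ s :* s
      := s′ :* s′ :+ (a :* a :+ (con 1 :+ a) :* (con 1 :+ a))) refl

consecutiveLegs-hypotenuse>0 : ∀ {a s} → ConsecutiveLegs a s → 0 < s
consecutiveLegs-hypotenuse>0 {a} {zero}  legs with () ← m+n≡0⇒n≡0 (a * a) legs
consecutiveLegs-hypotenuse>0 {a} {suc s} _    = z<s

consecutiveLegs-unbounded : ∀ n → Σ ℕ λ a → Σ ℕ λ s → n ≤ a × ConsecutiveLegs a s
consecutiveLegs-unbounded zero = 0 , 1 , z≤n , refl
consecutiveLegs-unbounded (suc n) with consecutiveLegs-unbounded n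
... | a , s , n≤a , legs = 3 * a + 2 * s + 1 , 4 * a + 3 * s + 2 , n<a′ , consecutiveLegs-next {a} {s} legs
  where
  n<a′ : suc n ≤ 3 * a + 2 * s + 1
  n<a′ = ≤-trans (s≤s n≤a) (≤-trans (m≤n+m (suc a) (2 * a + 2 * s))
           (≤-reflexive (solve 2 (λ a s → con 2 :* a :+ con 2 :* s :+ (con 1 :+ a)
                                          := con 3 :* a :+ con 2 :* s :+ con 1) refl a s)))

square-repdigit : ∀ {a s} → ConsecutiveLegs a s →
                  let b = 1 + 2 * a in (2 * suc a * s) ^ 2 ≡ suc a * (1 + b + b ^ 2 + b ^ 3)
square-repdigit {a} {s} legs = begin
  (2 * suc a * s) ^ 2                        ≡⟨ square-product a s ⟩
  (2 * suc a) ^ 2 * (s * s)                  ≡⟨ cong ((2 * suc a) ^ 2 *_) legs ⟨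
  (2 * suc a) ^ 2 * (a * a + suc a * suc a)  ≡⟨ factorisation a ⟩
  suc a * (1 + b + b ^ 2 + b ^ 3)            ∎
  where
  open ≡-Reasoning
  b = 1 + 2 * a
  square-product : ∀ a s → (2 * suc a * s) ^ 2 ≡ (2 * suc a) ^ 2 * (s * s)
  square-product = solve 2 (λ a s → (con 2 :* (con 1 :+ a) :* s) :^ 2
                                   := (con 2 :* (con 1 :+ a)) :^ 2 :* (s :* s)) refl
  factorisation : ∀ a → let b = 1 + 2 * a in
                  (2 * suc a) ^ 2 * (a * a + suc a * suc a) ≡ suc a * (1 + b + b ^ 2 + b ^ 3)
  factorisation = solve 1 (λ a → let b = con 1 :+ con 2 :* a in
    (con 2 :* (con 1 :+ a)) :^ 2 :* (a :* a :+ (con 1 :+ a) :* (con 1 :+ a))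
      := (con 1 :+ a) :* (con 1 :+ b :+ b :^ 2 :+ b :^ 3)) refl

∉-beyond-max : ∀ {A : Set} (L : List (ℕ × A)) {x y} → max 0 (map proj₁ L) < x → ¬ ((x , y) ∈ L)
∉-beyond-max L x>max x∈L = <⇒≱ x>max (lookup (xs≤max 0 (map proj₁ L)) (∈-map⁺ proj₁ x∈L))

module RepdigitSquare (a s : ℕ) (a≥1 : 1 ≤ a) (legs : ConsecutiveLegs a s) where

  b : ℕ
  b = 1 + 2 * a

  y : ℕ
  y = 2 * suc a * s

  b≥2 : 2 ≤ b
  b≥2 = s≤s (≤-trans a≥1 (m≤m+n a (1 * a)))

  a≤b : a ≤ b
  a≤b = ≤-trans (m≤m+n a (1 * a)) (n≤1+n (2 * a))

  y≥1 : 1 ≤ y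
  y≥1 = *-mono-≤ {1} {2 * suc a} (s≤s z≤n) (consecutiveLegs-hypotenuse>0 {a} {s} legs)

  c<b : suc a < b
  c<b = s≤s (≤-trans (≤-reflexive (+-comm 1 a)) (+-monoʳ-≤ a (≤-trans a≥1 (≤-reflexive (sym (*-identityˡ a))))))

  w : List (Fin b)
  w = fromℕ< c<b ∷ []

  repr-y² : repr b (y ^ 2) ≡ map toℕ (w ↑ 4)
  repr-y² = begin
    repr b (y ^ 2)                                   ≡⟨ cong (λ m → repr b m) (square-repdigit {a} {s} legs) ⟩
    repr b (suc a * (1 + b + b ^ 2 + b ^ 3))
      ≡⟨ cong (λ c → repr b (c * (1 + b + b ^ 2 + b ^ 3))) (toℕ-fromℕ< c<b) ⟨
    repr b (toℕ (fromℕ< c<b) * (1 + b + b ^ 2 + b ^ 3)) ≡⟨ cong (λ m → repr b m) (fromDigits-↑4 (fromℕ< c<b)) ⟨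
    repr b (fromDigits (w ↑ 4))                      ≡⟨ repr-fromDigits (w ↑ 4) (z<s ∷ z<s ∷ z<s ∷ z<s ∷ []) ⟩
    map toℕ (w ↑ 4)                                  ∎
    where open ≡-Reasoning

mainTheorem13 : (L : List (ℕ × ℕ)) →
    Σ ℕ λ b → Σ ℕ λ y → Σ (2 ≤ b) λ b≥2 →
      (1 ≤ y) × ¬ ((b , y) ∈ L) ×
      (Σ (List (Fin b)) λ w → (length w ≡ 1) ×
        (repr b (y ^ 2) {{base≥2⇒NonZero b≥2}} ≡ map toℕ (w ↑ 4)))
mainTheorem13 L =
  let a , s , a>max , legs = consecutiveLegs-unbounded (suc (max 0 (map proj₁ L)))
      open RepdigitSquare a s (≤-trans (s≤s z≤n) a>max) legs
  in b , y , b≥2 , y≥1 , ∉-beyond-max L (<-≤-trans a>max a≤b) , w , refl , repr-y²
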